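{- Every reflexive presentation $P$ is cofibrant, in the sense that the initial morphism $\emptyset\to P$ belongs to the class of cofibrations $\mathcal{C}$, i.e. has the left lifting property with respect to every morphism having the right lifting property with respect to all morphisms of $\mathcal{I}$.
   Context: We work in the category $\mathbf{rPres}$ of reflexive presentations of monoids (a presentation $P$ has generators $P_1$ and relations $P_2\subseteq P_1^*\times P_1^*$, reflexive meaning $u\to u\in P_2$ for all $u\in P_1^*$; morphisms are maps on generators sending relations to relations). The initial object $\emptyset$ is the empty presentation. Let $G$ be the presentation with one generator $a$ and (apart from reflexivity relations) no relation, $G^n$ the one with generators $a_1,\dots,a_n$ and no relation, and $R^{m,n}$ the one with generators $a_1,\dots,a_{m+n}$ and the single relation $a_1\cdots a_m\to a_{m+1}\cdots a_{m+n}$ (plus reflexivity relations). The class $\mathcal{I}$ of generating cofibrations consists of the inclusions $\emptyset\to G$ and $G^{m+n}\to R^{m,n}$ for $m,n\in\mathbb{N}$. -}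

module Defs where

open import Data.Empty using (⊥; ⊥-elim)
open import Data.Unit using (⊤; tt)
open import Data.Nat using (ℕ; _+_)
open import Data.Fin using (Fin; _↑ˡ_; _↑ʳ_)
open import Data.List using (List; map; allFin)
open import Data.Product using (Σ; _×_; _,_)
open import Data.Sum using (_⊎_)
open import Relation.Binary.PropositionalEquality using (_≡_; refl; cong)

-- A reflexive presentation of a monoid: a set of generators P₁ and a
-- relation set P₂ ⊆ P₁* × P₁* (given as a predicate on pairs of words),
-- containing u → u for every word u.
record Pres : Set₁ where
  field
    Gen  : Set
    Rel  : List Gen → List Gen → Set
    rrefl : ∀ u → Rel u u
open Pres public

record Hom (P Q : Pres) : Set where
  field
    fun  : Gen P → Gen Q
    pres : ∀ {u v} → Rel P u v → Rel Q (map fun u) (map fun v)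
open Hom public

Free : Set → Pres
Free X = record { Gen = X ; Rel = _≡_ ; rrefl = λ u → refl }

∅P : Pres
∅P = Free ⊥

GP : Pres
GP = Free ⊤

G^ : ℕ → Pres
G^ n = Free (Fin n)

-- R^{m,n}: generators a₁ … a_{m+n}, single relation a₁⋯aₘ → a_{m+1}⋯a_{m+n},
-- plus the reflexivity relations.
lhsW : (m n : ℕ) → List (Fin (m + n))
lhsW m n = map (λ i → i ↑ˡ n) (allFin m)

rhsW : (m n : ℕ) → List (Fin (m + n))
rhsW m n = map (λ i → m ↑ʳ i) (allFin n)

R^ : ℕ → ℕ → Pres
R^ m n = record
  { Gen = Fin (m + n)
  ; Rel = λ u v → (u ≡ v) ⊎ ((u ≡ lhsW m n) × (v ≡ rhsW m n))
  ; rrefl = λ u → Data.Sum.inj₁ refl }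

initial : (P : Pres) → Hom ∅P P
initial P = record { fun = ⊥-elim ; pres = λ {u} {v} e → helper e }
  where
    helper : ∀ {u v : List ⊥} → u ≡ v → Rel P (map ⊥-elim u) (map ⊥-elim v)
    helper {u} refl = rrefl P (map ⊥-elim u)

∅→G : Hom ∅P GP
∅→G = initial GP

G→R : (m n : ℕ) → Hom (G^ (m + n)) (R^ m n)
G→R m n = record { fun = λ x → x ; pres = λ e → Data.Sum.inj₁ (cong (map (λ x → x)) e) }

data InI : {A B : Pres} → Hom A B → Set₁ where
  inI-G : InI ∅→G
  inI-R : (m n : ℕ) → InI (G→R m n)

-- Lifting property: i has the LLP w.r.t. p (equivalently p has the RLP
-- w.r.t. i). Equality of morphisms is equality of the underlying maps on
-- generators (pointwise).
LLP : {A B X Y : Pres} → Hom A B → Hom X Y → Set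
LLP {A} {B} {X} {Y} i p =
  (u : Hom A X) (v : Hom B Y) →
  (∀ a → fun p (fun u a) ≡ fun v (fun i a)) →
  Σ (Hom B X) λ h →
    (∀ a → fun h (fun i a) ≡ fun u a) × (∀ b → fun p (fun h b) ≡ fun v b)

RLP-I : {X Y : Pres} → Hom X Y → Set₁
RLP-I p = ∀ {A B} (i : Hom A B) → InI i → LLP i p

IsCofibration : {A B : Pres} → Hom A B → Set₁
IsCofibration i = ∀ {X Y : Pres} (p : Hom X Y) → RLP-I p → LLP i p

{-# OPTIONS --safe #-}

-- A morphism p : X → Y with the RLP against ∅ → G is surjective on generators,
-- and one with the RLP against every G^{m+n} → R^{m,n} reflects relations: a
-- relation u → w of Y between p-images is a map out of R^{|u|,|w|}, and a lift
-- of it is a relation u → w of X. Choosing a p-preimage of the image of each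
-- generator of P therefore lifts any P → Y through p.
module Submission where

open import Defs
open import Data.Unit using (tt)
open import Data.Nat using (_+_)
open import Data.Fin using (Fin; zero; suc; _↑ˡ_; _↑ʳ_)
open import Data.List using (List; []; _∷_; map; allFin; tabulate; length; lookup)
open import Data.List.Properties using (map-cong; map-∘; map-tabulate; tabulate-lookup)
open import Data.Product using (Σ; _,_; proj₁; proj₂)
open import Data.Sum using (inj₁; inj₂)
open import Function using (_∘_)
open import Relation.Binary.PropositionalEquality
open ≡-Reasoning

freeHom : {S : Set} (Q : Pres) → (S → Gen Q) → Hom (Free S) Q
freeHom Q f = record { fun = f ; pres = λ { {u} refl → rrefl Q (map f u) } }

module _ {A : Set} where

  -- The generator tuple of R^{|u|,|w|} whose two relation sides spell u and w.
  lookup++ : (u w : List A) → Fin (length u + length w) → A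
  lookup++ []      w i       = lookup w i
  lookup++ (x ∷ u) w zero    = x
  lookup++ (x ∷ u) w (suc i) = lookup++ u w i

  tabulate-lookup++ˡ : (u w : List A) → tabulate (λ i → lookup++ u w (i ↑ˡ length w)) ≡ u
  tabulate-lookup++ˡ []      w = refl
  tabulate-lookup++ˡ (x ∷ u) w = cong (x ∷_) (tabulate-lookup++ˡ u w)

  tabulate-lookup++ʳ : (u w : List A) → tabulate (λ i → lookup++ u w (length u ↑ʳ i)) ≡ w
  tabulate-lookup++ʳ []      w = tabulate-lookup w
  tabulate-lookup++ʳ (x ∷ u) w = tabulate-lookup++ʳ u w

  map-lookup++-lhsW : (u w : List A) → map (lookup++ u w) (lhsW (length u) (length w)) ≡ u
  map-lookup++-lhsW u w = begin
    map (lookup++ u w) (map (_↑ˡ length w) (allFin (length u)))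
      ≡⟨ map-∘ (allFin (length u)) ⟨
    map (λ i → lookup++ u w (i ↑ˡ length w)) (allFin (length u))
      ≡⟨ map-tabulate (λ i → i) _ ⟩
    tabulate (λ i → lookup++ u w (i ↑ˡ length w))
      ≡⟨ tabulate-lookup++ˡ u w ⟩
    u ∎

  map-lookup++-rhsW : (u w : List A) → map (lookup++ u w) (rhsW (length u) (length w)) ≡ w
  map-lookup++-rhsW u w = begin
    map (lookup++ u w) (map (length u ↑ʳ_) (allFin (length w)))
      ≡⟨ map-∘ (allFin (length w)) ⟨
    map (λ i → lookup++ u w (length u ↑ʳ i)) (allFin (length w))
      ≡⟨ map-tabulate (λ i → i) _ ⟩
    tabulate (λ i → lookup++ u w (length u ↑ʳ i))
      ≡⟨ tabulate-lookup++ʳ u w ⟩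
    w ∎

map-lookup++-lhsW-∘ : {A B : Set} (f : A → B) (u w : List A) →
                      map (f ∘ lookup++ u w) (lhsW (length u) (length w)) ≡ map f u
map-lookup++-lhsW-∘ f u w = trans (map-∘ (lhsW (length u) (length w))) (cong (map f) (map-lookup++-lhsW u w))

map-lookup++-rhsW-∘ : {A B : Set} (f : A → B) (u w : List A) →
                      map (f ∘ lookup++ u w) (rhsW (length u) (length w)) ≡ map f w
map-lookup++-rhsW-∘ f u w = trans (map-∘ (rhsW (length u) (length w))) (cong (map f) (map-lookup++-rhsW u w))

wordPairHom : {A : Set} (Q : Pres) (f : A → Gen Q) {u w : List A} →
              Rel Q (map f u) (map f w) → Hom (R^ (length u) (length w)) Q
wordPairHom Q f {u} {w} r = record { fun = f ∘ lookup++ u w ; pres = pres-R }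
  where
    pres-R : ∀ {s t} → Rel (R^ (length u) (length w)) s t →
             Rel Q (map (f ∘ lookup++ u w) s) (map (f ∘ lookup++ u w) t)
    pres-R {s} (inj₁ refl)      = rrefl Q (map (f ∘ lookup++ u w) s)
    pres-R (inj₂ (refl , refl)) =
      subst₂ (Rel Q) (sym (map-lookup++-lhsW-∘ f u w)) (sym (map-lookup++-rhsW-∘ f u w)) r

module _ {X Y : Pres} (p : Hom X Y) (rlp : RLP-I p) where

  RLP-I⇒surjective : (y : Gen Y) → Σ (Gen X) λ x → fun p x ≡ y
  RLP-I⇒surjective y with rlp ∅→G inI-G (initial X) (freeHom Y (λ _ → y)) (λ ())
  ... | lift , _ , lift-commutes = fun lift tt , lift-commutes tt

  RLP-I⇒reflects-Rel : {u w : List (Gen X)} → Rel Y (map (fun p) u) (map (fun p) w) → Rel X u w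
  RLP-I⇒reflects-Rel {u} {w} r
    with rlp (G→R (length u) (length w)) (inI-R (length u) (length w))
             (freeHom X (lookup++ u w)) (wordPairHom Y (fun p) r) (λ _ → refl)
  ... | lift , lift-extends , _ =
    subst₂ (Rel X) (lift-spells (lhsW (length u) (length w)) (map-lookup++-lhsW u w))
                   (lift-spells (rhsW (length u) (length w)) (map-lookup++-rhsW u w))
                   (pres lift (inj₂ (refl , refl)))
    where
      lift-spells : ∀ s {v} → map (lookup++ u w) s ≡ v → map (fun lift) s ≡ v
      lift-spells s = trans (map-cong lift-extends s)

mainTheorem10 : (P : Pres) → IsCofibration (initial P)
mainTheorem10 P {X} {Y} p rlp _ v _ = lift , (λ ()) , section-commutes
  where
    section : Gen P → Gen X
    section g = proj₁ (RLP-I⇒surjective p rlp (fun v g))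
    section-commutes : ∀ g → fun p (section g) ≡ fun v g
    section-commutes g = proj₂ (RLP-I⇒surjective p rlp (fun v g))
    p∘section : ∀ a → map (fun p) (map section a) ≡ map (fun v) a
    p∘section a = trans (sym (map-∘ a)) (map-cong section-commutes a)
    lift : Hom P X
    lift = record
      { fun  = section
      ; pres = λ {a} {b} r → RLP-I⇒reflects-Rel p rlp
                 (subst₂ (Rel Y) (sym (p∘section a)) (sym (p∘section b)) (pres v r))
      }
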